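{- For every integer $p\ge1$, all integers $0\le k\le n$ and real $x$, \[ \sum_{j=0}^{n-k}\binom{n-k}{j}(-1)^{j}E_{j+k}^{(p)}(x)=(-1)^{n+k+1}\sum_{j=0}^{k}\binom{k}{j}E_{n-j}^{(p)}(x)+2(-1)^{n+k}\sum_{j=0}^{k}\binom{k}{j}E_{n-j}^{(p-1)}(x-1). \]
   Context: For an integer $p\ge0$, the higher-order (multidimensional) Euler polynomials $E_n^{(p)}(x)$ are defined by $\sum_{n\ge0}E_n^{(p)}(x)\frac{t^n}{n!}=e^{xt}\left(\frac{2}{e^t+1}\right)^p$; in particular $E_n^{(0)}(x)=x^n$.
   Formalization: The variable x ranges over the rationals rather than the reals. -}

module Defs where

open import Data.Nat using (ℕ; zero; suc; _∸_; _≟_)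
open import Data.Nat.Combinatorics using (_C_)
open import Data.Integer using (+_)
open import Data.Rational using (ℚ; 0ℚ; 1ℚ; ½; _+_; _*_; -_; _/_)
open import Relation.Nullary using (yes; no)

ℕ→ℚ : ℕ → ℚ
ℕ→ℚ n = (+ n) / 1

infixr 8 _^_
_^_ : ℚ → ℕ → ℚ
x ^ zero = 1ℚ
x ^ suc n = x * (x ^ n)

sgn : ℕ → ℚ
sgn m = (- 1ℚ) ^ m

sumTo : ℕ → (ℕ → ℚ) → ℚ
sumTo zero f = f 0
sumTo (suc n) f = sumTo n f + f (suc n)

-- Exponential formal power series: a sequence a represents Σ a n t^n / n!.
-- Product of EGFs: (a ⊛ b) n = Σ_{k=0}^{n} C(n,k) a k b (n-k).
infixl 7 _⊛_
_⊛_ : (ℕ → ℚ) → (ℕ → ℚ) → (ℕ → ℚ)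
(a ⊛ b) n = sumTo n (λ k → ℕ→ℚ (n C k) * a k * b (n ∸ k))

expSeries : ℚ → ℕ → ℚ
expSeries x n = x ^ n

oneSeries : ℕ → ℚ
oneSeries zero = 1ℚ
oneSeries (suc _) = 0ℚ

-- EGF coefficients c of 2/(e^t+1), determined by (e^t + 1) · c = 2:
--   c 0 = 1,  c (m+1) = -(1/2) Σ_{j=0}^{m} C(m+1,j) c j.
-- cTab n k = c k for k ≤ n (course-of-values table).
cTab : ℕ → ℕ → ℚ
cTab zero k = 1ℚ
cTab (suc n) k with k ≟ suc n
... | yes _ = - (½ * sumTo n (λ j → ℕ→ℚ (suc n C j) * cTab n j))
... | no _ = cTab n k

twoOverExpPlusOne : ℕ → ℚ
twoOverExpPlusOne k = cTab k k

powSeries : ℕ → ℕ → ℚ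
powSeries zero = oneSeries
powSeries (suc p) = twoOverExpPlusOne ⊛ powSeries p

-- Higher-order Euler polynomial  E_n^{(p)}(x) = n! [t^n] e^{xt} (2/(e^t+1))^p
EulerP : ℕ → ℕ → ℚ → ℚ
EulerP p n x = (expSeries x ⊛ powSeries p) n

{-# OPTIONS --safe #-}
-- With A_n = E_n^{(p)}(x) and B_n = E_n^{(p-1)}(x-1), multiplying e^{xt} (2/(eᵗ+1))^p by eᵗ + 1
-- and writing e^{xt} = eᵗ e^{(x-1)t} gives (eᵗ + 1) A = 2 eᵗ B, i.e. A = eᵗ D for D = 2B - A:
-- A_m = Σ_j C(m,j) D_{m-j}.  For any such pair,
-- Σ_j C(m,j) (-1)^j A_{j+k} = (-1)^m Σ_j C(k,j) D_{m+k-j}: for m = 0 this is A = eᵗ D, and both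
-- sides obey the same Pascal recurrence in m.  Taking m = n - k and splitting D into 2B - A gives
-- the theorem.
module Submission where

open import Defs
open import Data.Nat using (ℕ; _≤_; _∸_; _+_)
open import Data.Nat.Combinatorics using (_C_)
open import Data.Rational using (ℚ; 1ℚ; _*_; _-_)
open import Relation.Binary.PropositionalEquality using (_≡_)

open import Data.Nat using (zero; suc; z≤n; s≤s)
import Data.Nat.Properties as ℕₚ
open import Data.Nat.Combinatorics using (nCk+nC[k+1]≡[n+1]C[k+1]; nCn≡1; k>n⇒nCk≡0)
import Data.Nat.Coprimality as Coprimality
open import Data.Integer using (+_)
import Data.Integer as ℤ
import Data.Integer.Properties as ℤₚ
import Data.Rational as ℚ
open import Data.Rational using (0ℚ; ½; mkℚ; -_)
import Data.Rational.Properties as ℚₚ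
open import Data.Rational.Solver using (module +-*-Solver)
open +-*-Solver using (solve; _:+_; _:*_; :-_; _:-_; _:=_; con)
open import Algebra.Bundles using (CommutativeMonoid)
open import Algebra.Properties.CommutativeSemigroup (CommutativeMonoid.commutativeSemigroup ℚₚ.+-0-commutativeMonoid)
  using (interchange)
open import Data.Sum using (inj₁; inj₂)
open import Data.Empty using (⊥-elim)
open import Relation.Nullary using (yes; no)
open import Relation.Binary.PropositionalEquality using (_≗_; refl; sym; trans; cong; cong₂; module ≡-Reasoning)

ℕ→ℚ≡mkℚ : ∀ n → ℕ→ℚ n ≡ mkℚ (+ n) 0 (Coprimality.sym (Coprimality.1-coprimeTo n))
ℕ→ℚ≡mkℚ n = ℚₚ.normalize-coprime (Coprimality.sym (Coprimality.1-coprimeTo n))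

ℕ→ℚ-homo-+ : ∀ m n → ℕ→ℚ (m + n) ≡ ℕ→ℚ m ℚ.+ ℕ→ℚ n
-- On integers over 1, ℚ addition computes to (m * 1 + n * 1) / (1 * 1).
ℕ→ℚ-homo-+ m n rewrite ℕ→ℚ≡mkℚ m | ℕ→ℚ≡mkℚ n =
  cong (ℚ._/ 1) (trans (ℤₚ.pos-+ m n) (sym (cong₂ ℤ._+_ (ℤₚ.*-identityʳ (+ m)) (ℤₚ.*-identityʳ (+ n)))))

1ℚ^n≡1ℚ : ∀ n → 1ℚ ^ n ≡ 1ℚ
1ℚ^n≡1ℚ zero    = refl
1ℚ^n≡1ℚ (suc n) = trans (ℚₚ.*-identityˡ (1ℚ ^ n)) (1ℚ^n≡1ℚ n)

sgn-homo-+ : ∀ m n → sgn (m + n) ≡ sgn m * sgn n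
sgn-homo-+ zero    n = sym (ℚₚ.*-identityˡ (sgn n))
sgn-homo-+ (suc m) n = trans (cong (- 1ℚ *_) (sgn-homo-+ m n)) (sym (ℚₚ.*-assoc (- 1ℚ) (sgn m) (sgn n)))

sgn*sgn≡1 : ∀ n → sgn n * sgn n ≡ 1ℚ
sgn*sgn≡1 zero    = refl
sgn*sgn≡1 (suc n) =
  trans (solve 1 (λ s → (con (- 1ℚ) :* s) :* (con (- 1ℚ) :* s) := s :* s) refl (sgn n)) (sgn*sgn≡1 n)

sgn[n∸k]≡sgn[n+k] : ∀ {n k} → k ≤ n → sgn (n ∸ k) ≡ sgn (n + k)
sgn[n∸k]≡sgn[n+k] {n} {k} k≤n = begin
  sgn (n ∸ k)                    ≡⟨ sym (ℚₚ.*-identityʳ (sgn (n ∸ k))) ⟩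
  sgn (n ∸ k) * 1ℚ               ≡⟨ cong (sgn (n ∸ k) *_) (sym (sgn*sgn≡1 k)) ⟩
  sgn (n ∸ k) * (sgn k * sgn k)  ≡⟨ sym (ℚₚ.*-assoc (sgn (n ∸ k)) (sgn k) (sgn k)) ⟩
  sgn (n ∸ k) * sgn k * sgn k    ≡⟨ cong (_* sgn k) (sym (sgn-homo-+ (n ∸ k) k)) ⟩
  sgn (n ∸ k + k) * sgn k        ≡⟨ cong (λ m → sgn m * sgn k) (ℕₚ.m∸n+n≡m k≤n) ⟩
  sgn n * sgn k                  ≡⟨ sym (sgn-homo-+ n k) ⟩
  sgn (n + k)                    ∎
  where open ≡-Reasoning

infixl 6 _⊕_
_⊕_ : (ℕ → ℚ) → (ℕ → ℚ) → ℕ → ℚ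
(f ⊕ g) n = f n ℚ.+ g n

infixr 8 _·_
_·_ : ℚ → (ℕ → ℚ) → ℕ → ℚ
(s · f) n = s * f n

-- The index shift, i.e. differentiation of exponential generating functions.
∂ : (ℕ → ℚ) → ℕ → ℚ
∂ f n = f (suc n)

sumTo-cong : ∀ n {f g : ℕ → ℚ} → (∀ i → i ≤ n → f i ≡ g i) → sumTo n f ≡ sumTo n g
sumTo-cong zero    f≡g = f≡g 0 z≤n
sumTo-cong (suc n) f≡g =
  cong₂ ℚ._+_ (sumTo-cong n (λ i i≤n → f≡g i (ℕₚ.m≤n⇒m≤1+n i≤n))) (f≡g (suc n) ℕₚ.≤-refl)

sumTo-0ℚ : ∀ n → sumTo n (λ _ → 0ℚ) ≡ 0ℚ
sumTo-0ℚ zero    = refl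
sumTo-0ℚ (suc n) = cong (ℚ._+ 0ℚ) (sumTo-0ℚ n)

sumTo-distrib-⊕ : ∀ n (f g : ℕ → ℚ) → sumTo n (f ⊕ g) ≡ sumTo n f ℚ.+ sumTo n g
sumTo-distrib-⊕ zero    f g = refl
sumTo-distrib-⊕ (suc n) f g =
  trans (cong (ℚ._+ (f (suc n) ℚ.+ g (suc n))) (sumTo-distrib-⊕ n f g))
        (interchange (sumTo n f) (sumTo n g) (f (suc n)) (g (suc n)))

*-distribˡ-sumTo : ∀ n s (f : ℕ → ℚ) → s * sumTo n f ≡ sumTo n (s · f)
*-distribˡ-sumTo zero    s f = refl
*-distribˡ-sumTo (suc n) s f =
  trans (ℚₚ.*-distribˡ-+ s (sumTo n f) (f (suc n))) (cong (ℚ._+ s * f (suc n)) (*-distribˡ-sumTo n s f))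

sumTo-suc-head : ∀ n (f : ℕ → ℚ) → sumTo (suc n) f ≡ f 0 ℚ.+ sumTo n (∂ f)
sumTo-suc-head zero    f = refl
sumTo-suc-head (suc n) f =
  trans (cong (ℚ._+ f (suc (suc n))) (sumTo-suc-head n f)) (ℚₚ.+-assoc (f 0) (sumTo n (∂ f)) (f (suc (suc n))))

binomialSum : ℕ → (ℕ → ℚ) → ℚ
binomialSum m h = sumTo m (λ j → ℕ→ℚ (m C j) * h j)

binomialSum-suc : ∀ m h → binomialSum (suc m) h ≡ binomialSum m h ℚ.+ binomialSum m (∂ h)
binomialSum-suc m h = begin
  binomialSum (suc m) h                                         ≡⟨ sumTo-suc-head m _ ⟩
  1ℚ * h 0 ℚ.+ sumTo m (λ i → ℕ→ℚ (suc m C suc i) * h (suc i))  ≡⟨ cong (1ℚ * h 0 ℚ.+_) pascal ⟩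
  1ℚ * h 0 ℚ.+ (upper ℚ.+ binomialSum m (∂ h))                  ≡⟨ sym (ℚₚ.+-assoc (1ℚ * h 0) upper (binomialSum m (∂ h))) ⟩
  (1ℚ * h 0 ℚ.+ upper) ℚ.+ binomialSum m (∂ h)                  ≡⟨ cong (ℚ._+ binomialSum m (∂ h)) head+upper ⟩
  binomialSum m h ℚ.+ binomialSum m (∂ h)                       ∎
  where
  open ≡-Reasoning
  upper : ℚ
  upper = sumTo m (λ i → ℕ→ℚ (m C suc i) * h (suc i))
  pascal : sumTo m (λ i → ℕ→ℚ (suc m C suc i) * h (suc i)) ≡ upper ℚ.+ binomialSum m (∂ h)
  pascal = trans (sumTo-cong m (λ i _ → term i)) (sumTo-distrib-⊕ m _ _)
    where
    term : ∀ i → ℕ→ℚ (suc m C suc i) * h (suc i) ≡ ℕ→ℚ (m C suc i) * h (suc i) ℚ.+ ℕ→ℚ (m C i) * h (suc i)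
    term i = begin
      ℕ→ℚ (suc m C suc i) * h (suc i)                    ≡⟨ cong (λ c → ℕ→ℚ c * h (suc i)) (sym (nCk+nC[k+1]≡[n+1]C[k+1] m i)) ⟩
      ℕ→ℚ (m C i + m C suc i) * h (suc i)                ≡⟨ cong (λ c → ℕ→ℚ c * h (suc i)) (ℕₚ.+-comm (m C i) (m C suc i)) ⟩
      ℕ→ℚ (m C suc i + m C i) * h (suc i)                ≡⟨ cong (_* h (suc i)) (ℕ→ℚ-homo-+ (m C suc i) (m C i)) ⟩
      (ℕ→ℚ (m C suc i) ℚ.+ ℕ→ℚ (m C i)) * h (suc i)      ≡⟨ ℚₚ.*-distribʳ-+ (h (suc i)) (ℕ→ℚ (m C suc i)) (ℕ→ℚ (m C i)) ⟩
      ℕ→ℚ (m C suc i) * h (suc i) ℚ.+ ℕ→ℚ (m C i) * h (suc i) ∎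
  head+upper : 1ℚ * h 0 ℚ.+ upper ≡ binomialSum m h
  head+upper = begin
    1ℚ * h 0 ℚ.+ upper                                             ≡⟨ sym (sumTo-suc-head m _) ⟩
    binomialSum m h ℚ.+ ℕ→ℚ (m C suc m) * h (suc m)                ≡⟨ cong (λ c → binomialSum m h ℚ.+ ℕ→ℚ c * h (suc m)) (k>n⇒nCk≡0 (ℕₚ.n<1+n m)) ⟩
    binomialSum m h ℚ.+ 0ℚ * h (suc m)                             ≡⟨ cong (binomialSum m h ℚ.+_) (ℚₚ.*-zeroˡ (h (suc m))) ⟩
    binomialSum m h ℚ.+ 0ℚ                                         ≡⟨ ℚₚ.+-identityʳ _ ⟩
    binomialSum m h                                                ∎

binomialSum-linear : ∀ n s t (f g : ℕ → ℚ) →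
  binomialSum n (s · f ⊕ t · g) ≡ s * binomialSum n f ℚ.+ t * binomialSum n g
binomialSum-linear n s t f g = begin
  binomialSum n (s · f ⊕ t · g)                    ≡⟨ sumTo-cong n (λ j _ → term s t (ℕ→ℚ (n C j)) (f j) (g j)) ⟩
  sumTo n (s · cf ⊕ t · cg)                        ≡⟨ sumTo-distrib-⊕ n (s · cf) (t · cg) ⟩
  sumTo n (s · cf) ℚ.+ sumTo n (t · cg)            ≡⟨ sym (cong₂ ℚ._+_ (*-distribˡ-sumTo n s cf) (*-distribˡ-sumTo n t cg)) ⟩
  s * binomialSum n f ℚ.+ t * binomialSum n g      ∎
  where
  open ≡-Reasoning
  cf cg : ℕ → ℚ
  cf j = ℕ→ℚ (n C j) * f j
  cg j = ℕ→ℚ (n C j) * g j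
  term : ∀ s t c x y → c * (s * x ℚ.+ t * y) ≡ s * (c * x) ℚ.+ t * (c * y)
  term = solve 5 (λ s t c x y → c :* (s :* x :+ t :* y) := s :* (c :* x) :+ t :* (c :* y)) refl

∂-⊛ : ∀ f g → ∂ (f ⊛ g) ≗ f ⊛ ∂ g ⊕ ∂ f ⊛ g
∂-⊛ f g n = begin
  (f ⊛ g) (suc n)                                        ≡⟨ sumTo-cong (suc n) (λ k _ → ℚₚ.*-assoc (ℕ→ℚ (suc n C k)) (f k) (g (suc n ∸ k))) ⟩
  binomialSum (suc n) (λ k → f k * g (suc n ∸ k))        ≡⟨ binomialSum-suc n _ ⟩
  binomialSum n (λ k → f k * g (suc n ∸ k)) ℚ.+ binomialSum n (λ k → f (suc k) * g (n ∸ k))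
    ≡⟨ cong₂ ℚ._+_ (sumTo-cong n (λ k k≤n → trans (sym (ℚₚ.*-assoc (ℕ→ℚ (n C k)) (f k) (g (suc n ∸ k))))
                                                  (cong (λ i → ℕ→ℚ (n C k) * f k * g i) (ℕₚ.+-∸-assoc 1 k≤n))))
                   (sumTo-cong n (λ k _ → sym (ℚₚ.*-assoc (ℕ→ℚ (n C k)) (f (suc k)) (g (n ∸ k))))) ⟩
  (f ⊛ ∂ g) n ℚ.+ (∂ f ⊛ g) n                            ∎
  where open ≡-Reasoning

⊛-congˡ : ∀ f {g g′} → g ≗ g′ → f ⊛ g ≗ f ⊛ g′
⊛-congˡ f g≗g′ n = sumTo-cong n (λ k _ → cong (ℕ→ℚ (n C k) * f k *_) (g≗g′ (n ∸ k)))

⊛-congʳ : ∀ {f f′} g → f ≗ f′ → f ⊛ g ≗ f′ ⊛ g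
⊛-congʳ g f≗f′ n = sumTo-cong n (λ k _ → cong (λ u → ℕ→ℚ (n C k) * u * g (n ∸ k)) (f≗f′ k))

⊛-comm : ∀ f g → f ⊛ g ≗ g ⊛ f
⊛-comm f g zero    = solve 2 (λ u v → con 1ℚ :* u :* v := con 1ℚ :* v :* u) refl (f 0) (g 0)
⊛-comm f g (suc n) = begin
  (f ⊛ g) (suc n)                ≡⟨ ∂-⊛ f g n ⟩
  (f ⊛ ∂ g) n ℚ.+ (∂ f ⊛ g) n    ≡⟨ cong₂ ℚ._+_ (⊛-comm f (∂ g) n) (⊛-comm (∂ f) g n) ⟩
  (∂ g ⊛ f) n ℚ.+ (g ⊛ ∂ f) n    ≡⟨ ℚₚ.+-comm ((∂ g ⊛ f) n) ((g ⊛ ∂ f) n) ⟩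
  (g ⊛ ∂ f) n ℚ.+ (∂ g ⊛ f) n    ≡⟨ sym (∂-⊛ g f n) ⟩
  (g ⊛ f) (suc n)                ∎
  where open ≡-Reasoning

⊛-distribˡ-⊕ : ∀ f g h → f ⊛ (g ⊕ h) ≗ f ⊛ g ⊕ f ⊛ h
⊛-distribˡ-⊕ f g h n =
  trans (sumTo-cong n (λ k _ → ℚₚ.*-distribˡ-+ (ℕ→ℚ (n C k) * f k) (g (n ∸ k)) (h (n ∸ k))))
        (sumTo-distrib-⊕ n _ _)

⊛-distribʳ-⊕ : ∀ f g h → (f ⊕ g) ⊛ h ≗ f ⊛ h ⊕ g ⊛ h
⊛-distribʳ-⊕ f g h n =
  trans (sumTo-cong n (λ k _ → term (ℕ→ℚ (n C k)) (f k) (g k) (h (n ∸ k)))) (sumTo-distrib-⊕ n (λ k → ℕ→ℚ (n C k) * f k * h (n ∸ k)) (λ k → ℕ→ℚ (n C k) * g k * h (n ∸ k)))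
  where
  term : ∀ c x y z → c * (x ℚ.+ y) * z ≡ c * x * z ℚ.+ c * y * z
  term = solve 4 (λ c x y z → c :* (x :+ y) :* z := c :* x :* z :+ c :* y :* z) refl

⊛-scaleˡ : ∀ s f g → (s · f) ⊛ g ≗ s · (f ⊛ g)
⊛-scaleˡ s f g n =
  trans (sumTo-cong n (λ k _ → term s (ℕ→ℚ (n C k)) (f k) (g (n ∸ k)))) (sym (*-distribˡ-sumTo n s _))
  where
  term : ∀ s c x y → c * (s * x) * y ≡ s * (c * x * y)
  term = solve 4 (λ s c x y → c :* (s :* x) :* y := s :* (c :* x :* y)) refl

⊛-scaleʳ : ∀ s f g → f ⊛ (s · g) ≗ s · (f ⊛ g)
⊛-scaleʳ s f g n =
  trans (sumTo-cong n (λ k _ → term s (ℕ→ℚ (n C k)) (f k) (g (n ∸ k)))) (sym (*-distribˡ-sumTo n s _))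
  where
  term : ∀ s c x y → c * x * (s * y) ≡ s * (c * x * y)
  term = solve 4 (λ s c x y → c :* x :* (s :* y) := s :* (c :* x :* y)) refl

⊛-assoc : ∀ f g h → (f ⊛ g) ⊛ h ≗ f ⊛ (g ⊛ h)
⊛-assoc f g h zero =
  solve 3 (λ x y z → con 1ℚ :* (con 1ℚ :* x :* y) :* z := con 1ℚ :* x :* (con 1ℚ :* y :* z)) refl (f 0) (g 0) (h 0)
⊛-assoc f g h (suc n) = begin
  ((f ⊛ g) ⊛ h) (suc n)
    ≡⟨ ∂-⊛ (f ⊛ g) h n ⟩
  ((f ⊛ g) ⊛ ∂ h) n ℚ.+ (∂ (f ⊛ g) ⊛ h) n
    ≡⟨ cong (((f ⊛ g) ⊛ ∂ h) n ℚ.+_) (trans (⊛-congʳ h (∂-⊛ f g) n) (⊛-distribʳ-⊕ (f ⊛ ∂ g) (∂ f ⊛ g) h n)) ⟩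
  ((f ⊛ g) ⊛ ∂ h) n ℚ.+ (((f ⊛ ∂ g) ⊛ h) n ℚ.+ ((∂ f ⊛ g) ⊛ h) n)
    ≡⟨ cong₂ ℚ._+_ (⊛-assoc f g (∂ h) n) (cong₂ ℚ._+_ (⊛-assoc f (∂ g) h n) (⊛-assoc (∂ f) g h n)) ⟩
  (f ⊛ (g ⊛ ∂ h)) n ℚ.+ ((f ⊛ (∂ g ⊛ h)) n ℚ.+ (∂ f ⊛ (g ⊛ h)) n)
    ≡⟨ sym (ℚₚ.+-assoc ((f ⊛ (g ⊛ ∂ h)) n) ((f ⊛ (∂ g ⊛ h)) n) ((∂ f ⊛ (g ⊛ h)) n)) ⟩
  ((f ⊛ (g ⊛ ∂ h)) n ℚ.+ (f ⊛ (∂ g ⊛ h)) n) ℚ.+ (∂ f ⊛ (g ⊛ h)) n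
    ≡⟨ cong (ℚ._+ (∂ f ⊛ (g ⊛ h)) n) (sym (trans (⊛-congˡ f (∂-⊛ g h) n) (⊛-distribˡ-⊕ f (g ⊛ ∂ h) (∂ g ⊛ h) n))) ⟩
  (f ⊛ ∂ (g ⊛ h)) n ℚ.+ (∂ f ⊛ (g ⊛ h)) n
    ≡⟨ sym (∂-⊛ f (g ⊛ h) n) ⟩
  (f ⊛ (g ⊛ h)) (suc n) ∎
  where open ≡-Reasoning

⊛-identityˡ : ∀ g → oneSeries ⊛ g ≗ g
⊛-identityˡ g zero    = ℚₚ.*-identityˡ (g 0)
⊛-identityˡ g (suc n) = begin
  (oneSeries ⊛ g) (suc n)                                                 ≡⟨ sumTo-suc-head n _ ⟩
  1ℚ * 1ℚ * g (suc n) ℚ.+ sumTo n (λ i → ℕ→ℚ (suc n C suc i) * 0ℚ * g (n ∸ i))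
    ≡⟨ cong₂ ℚ._+_ (ℚₚ.*-identityˡ (g (suc n))) (trans (sumTo-cong n (λ i _ → vanish i)) (sumTo-0ℚ n)) ⟩
  g (suc n) ℚ.+ 0ℚ                                                        ≡⟨ ℚₚ.+-identityʳ (g (suc n)) ⟩
  g (suc n)                                                               ∎
  where
  open ≡-Reasoning
  vanish : ∀ i → ℕ→ℚ (suc n C suc i) * 0ℚ * g (n ∸ i) ≡ 0ℚ
  vanish i = trans (cong (_* g (n ∸ i)) (ℚₚ.*-zeroʳ (ℕ→ℚ (suc n C suc i)))) (ℚₚ.*-zeroˡ (g (n ∸ i)))

expSeries-+ : ∀ a b → expSeries a ⊛ expSeries b ≗ expSeries (a ℚ.+ b)
expSeries-+ a b zero    = refl
expSeries-+ a b (suc n) = begin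
  (expSeries a ⊛ expSeries b) (suc n)
    ≡⟨ ∂-⊛ (expSeries a) (expSeries b) n ⟩
  (expSeries a ⊛ b · expSeries b) n ℚ.+ (a · expSeries a ⊛ expSeries b) n
    ≡⟨ cong₂ ℚ._+_ (⊛-scaleʳ b (expSeries a) (expSeries b) n) (⊛-scaleˡ a (expSeries a) (expSeries b) n) ⟩
  b * (expSeries a ⊛ expSeries b) n ℚ.+ a * (expSeries a ⊛ expSeries b) n
    ≡⟨ cong (λ z → b * z ℚ.+ a * z) (expSeries-+ a b n) ⟩
  b * (a ℚ.+ b) ^ n ℚ.+ a * (a ℚ.+ b) ^ n
    ≡⟨ solve 3 (λ a b z → b :* z :+ a :* z := (a :+ b) :* z) refl a b ((a ℚ.+ b) ^ n) ⟩
  (a ℚ.+ b) ^ suc n ∎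
  where open ≡-Reasoning

⊛-expSeries-1ℚ : ∀ f n → (f ⊛ expSeries 1ℚ) n ≡ binomialSum n f
⊛-expSeries-1ℚ f n = sumTo-cong n (λ j _ →
  trans (cong (ℕ→ℚ (n C j) * f j *_) (1ℚ^n≡1ℚ (n ∸ j))) (ℚₚ.*-identityʳ (ℕ→ℚ (n C j) * f j)))

expSeries-1ℚ-⊛ : ∀ f n → (expSeries 1ℚ ⊛ f) n ≡ binomialSum n (λ j → f (n ∸ j))
expSeries-1ℚ-⊛ f n = sumTo-cong n (λ j _ →
  cong (_* f (n ∸ j)) (trans (cong (ℕ→ℚ (n C j) *_) (1ℚ^n≡1ℚ j)) (ℚₚ.*-identityʳ (ℕ→ℚ (n C j)))))

cTab-suc : ∀ n k → k ≤ n → cTab (suc n) k ≡ cTab n k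
cTab-suc n k k≤n with k ℕₚ.≟ suc n
... | yes refl = ⊥-elim (ℕₚ.<-irrefl refl k≤n)
... | no _     = refl

cTab-stable : ∀ n k → k ≤ n → cTab n k ≡ twoOverExpPlusOne k
cTab-stable zero    .zero z≤n = refl
cTab-stable (suc n) k k≤1+n with ℕₚ.m≤n⇒m<n∨m≡n k≤1+n
... | inj₂ refl      = refl
... | inj₁ (s≤s k≤n) = trans (cTab-suc n k k≤n) (cTab-stable n k k≤n)

twoOverExpPlusOne-suc : ∀ m →
  twoOverExpPlusOne (suc m) ≡ - (½ * sumTo m (λ j → ℕ→ℚ (suc m C j) * twoOverExpPlusOne j))
twoOverExpPlusOne-suc m with suc m ℕₚ.≟ suc m
... | yes _ = cong (λ s → - (½ * s)) (sumTo-cong m (λ j j≤m → cong (ℕ→ℚ (suc m C j) *_) (cTab-stable m j j≤m)))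
... | no m≢m = ⊥-elim (m≢m refl)

twoOverExpPlusOne-spec : expSeries 1ℚ ⊛ twoOverExpPlusOne ⊕ twoOverExpPlusOne ≗ ℕ→ℚ 2 · oneSeries
twoOverExpPlusOne-spec zero    = refl
twoOverExpPlusOne-spec (suc m) = begin
  (expSeries 1ℚ ⊛ c) (suc m) ℚ.+ c (suc m)
    ≡⟨ cong (ℚ._+ c (suc m)) (trans (⊛-comm (expSeries 1ℚ) c (suc m)) (⊛-expSeries-1ℚ c (suc m))) ⟩
  (S ℚ.+ ℕ→ℚ (suc m C suc m) * c (suc m)) ℚ.+ c (suc m)
    ≡⟨ cong (λ i → (S ℚ.+ ℕ→ℚ i * c (suc m)) ℚ.+ c (suc m)) (nCn≡1 (suc m)) ⟩
  (S ℚ.+ 1ℚ * c (suc m)) ℚ.+ c (suc m)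
    ≡⟨ cong (λ z → (S ℚ.+ 1ℚ * z) ℚ.+ z) (twoOverExpPlusOne-suc m) ⟩
  (S ℚ.+ 1ℚ * - (½ * S)) ℚ.+ - (½ * S)
    ≡⟨ solve 1 (λ S → (S :+ con 1ℚ :* :- (con ½ :* S)) :+ :- (con ½ :* S) := con 0ℚ) refl S ⟩
  0ℚ ∎
  where
  open ≡-Reasoning
  c : ℕ → ℚ
  c = twoOverExpPlusOne
  S : ℚ
  S = sumTo m (λ j → ℕ→ℚ (suc m C j) * c j)

EulerP-spec : ∀ q x → let A = λ n → EulerP (suc q) n x
                          B = λ n → EulerP q n (x - 1ℚ)
                      in expSeries 1ℚ ⊛ A ⊕ A ≗ ℕ→ℚ 2 · (expSeries 1ℚ ⊛ B)
EulerP-spec q x n = begin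
  (e ⊛ (ex ⊛ (c ⊛ P))) n ℚ.+ (ex ⊛ (c ⊛ P)) n
    ≡⟨ cong (ℚ._+ (ex ⊛ (c ⊛ P)) n) (trans (sym (⊛-assoc e ex (c ⊛ P) n))
         (trans (⊛-congʳ (c ⊛ P) (⊛-comm e ex) n) (⊛-assoc ex e (c ⊛ P) n))) ⟩
  (ex ⊛ (e ⊛ (c ⊛ P))) n ℚ.+ (ex ⊛ (c ⊛ P)) n         ≡⟨ sym (⊛-distribˡ-⊕ ex (e ⊛ (c ⊛ P)) (c ⊛ P) n) ⟩
  (ex ⊛ (e ⊛ (c ⊛ P) ⊕ c ⊛ P)) n                      ≡⟨ ⊛-congˡ ex twoOverExpPlusOne-times-P n ⟩
  (ex ⊛ ℕ→ℚ 2 · P) n                                  ≡⟨ ⊛-scaleʳ (ℕ→ℚ 2) ex P n ⟩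
  ℕ→ℚ 2 * (ex ⊛ P) n                                  ≡⟨ cong (ℕ→ℚ 2 *_) (⊛-congʳ P ex≗e⊛ey n) ⟩
  ℕ→ℚ 2 * ((e ⊛ ey) ⊛ P) n                            ≡⟨ cong (ℕ→ℚ 2 *_) (⊛-assoc e ey P n) ⟩
  ℕ→ℚ 2 * (e ⊛ (ey ⊛ P)) n                            ∎
  where
  open ≡-Reasoning
  e ex ey c P : ℕ → ℚ
  e  = expSeries 1ℚ
  ex = expSeries x
  ey = expSeries (x - 1ℚ)
  c  = twoOverExpPlusOne
  P  = powSeries q
  twoOverExpPlusOne-times-P : e ⊛ (c ⊛ P) ⊕ c ⊛ P ≗ ℕ→ℚ 2 · P
  twoOverExpPlusOne-times-P i = begin
    (e ⊛ (c ⊛ P)) i ℚ.+ (c ⊛ P) i          ≡⟨ cong (ℚ._+ (c ⊛ P) i) (sym (⊛-assoc e c P i)) ⟩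
    ((e ⊛ c) ⊛ P) i ℚ.+ (c ⊛ P) i          ≡⟨ sym (⊛-distribʳ-⊕ (e ⊛ c) c P i) ⟩
    ((e ⊛ c ⊕ c) ⊛ P) i                    ≡⟨ ⊛-congʳ P twoOverExpPlusOne-spec i ⟩
    (ℕ→ℚ 2 · oneSeries ⊛ P) i              ≡⟨ ⊛-scaleˡ (ℕ→ℚ 2) oneSeries P i ⟩
    ℕ→ℚ 2 * (oneSeries ⊛ P) i              ≡⟨ cong (ℕ→ℚ 2 *_) (⊛-identityˡ P i) ⟩
    ℕ→ℚ 2 * P i                            ∎
  ex≗e⊛ey : ex ≗ e ⊛ ey
  ex≗e⊛ey i = sym (trans (expSeries-+ 1ℚ (x - 1ℚ) i)
                         (cong (λ y → expSeries y i) (solve 1 (λ x → con 1ℚ :+ (x :- con 1ℚ) := x) refl x)))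

alternatingSum : (ℕ → ℚ) → ℕ → ℕ → ℚ
alternatingSum a m k = sumTo m (λ j → ℕ→ℚ (m C j) * sgn j * a (j + k))

alternatingSum-suc : ∀ a m k → alternatingSum a (suc m) k ≡ alternatingSum a m k - alternatingSum a m (suc k)
alternatingSum-suc a m k = begin
  alternatingSum a (suc m) k
    ≡⟨ sumTo-cong (suc m) (λ j _ → ℚₚ.*-assoc (ℕ→ℚ (suc m C j)) (sgn j) (a (j + k))) ⟩
  binomialSum (suc m) h
    ≡⟨ binomialSum-suc m h ⟩
  binomialSum m h ℚ.+ binomialSum m (∂ h)
    ≡⟨ cong₂ ℚ._+_ (sumTo-cong m (λ j _ → sym (ℚₚ.*-assoc (ℕ→ℚ (m C j)) (sgn j) (a (j + k)))))
                   (trans (sumTo-cong m (λ j _ → shifted-term j)) (sym (*-distribˡ-sumTo m (- 1ℚ) _))) ⟩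
  alternatingSum a m k ℚ.+ - 1ℚ * alternatingSum a m (suc k)
    ≡⟨ solve 2 (λ u v → u :+ con (- 1ℚ) :* v := u :- v) refl (alternatingSum a m k) (alternatingSum a m (suc k)) ⟩
  alternatingSum a m k - alternatingSum a m (suc k) ∎
  where
  open ≡-Reasoning
  h : ℕ → ℚ
  h j = sgn j * a (j + k)
  shifted-term : ∀ j → ℕ→ℚ (m C j) * ∂ h j ≡ - 1ℚ * (ℕ→ℚ (m C j) * sgn j * a (j + suc k))
  shifted-term j = trans
    (solve 3 (λ c s y → c :* ((con (- 1ℚ) :* s) :* y) := con (- 1ℚ) :* (c :* s :* y)) refl (ℕ→ℚ (m C j)) (sgn j) (a (suc j + k)))
    (cong (λ i → - 1ℚ * (ℕ→ℚ (m C j) * sgn j * a i)) (sym (ℕₚ.+-suc j k)))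

alternatingSum-expSeries : ∀ {a} d → a ≗ expSeries 1ℚ ⊛ d →
  ∀ m k → alternatingSum a m k ≡ sgn m * binomialSum k (λ j → d (m + k ∸ j))
alternatingSum-expSeries {a} d a≗e⊛d zero k = begin
  1ℚ * 1ℚ * a k                              ≡⟨ solve 1 (λ y → con 1ℚ :* con 1ℚ :* y := y) refl (a k) ⟩
  a k                                        ≡⟨ trans (a≗e⊛d k) (expSeries-1ℚ-⊛ d k) ⟩
  binomialSum k (λ j → d (k ∸ j))            ≡⟨ sym (ℚₚ.*-identityˡ _) ⟩
  1ℚ * binomialSum k (λ j → d (k ∸ j))       ∎
  where open ≡-Reasoning
alternatingSum-expSeries {a} d a≗e⊛d (suc m) k = begin
  alternatingSum a (suc m) k
    ≡⟨ alternatingSum-suc a m k ⟩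
  alternatingSum a m k - alternatingSum a m (suc k)
    ≡⟨ cong₂ _-_ (alternatingSum-expSeries d a≗e⊛d m k) (alternatingSum-expSeries d a≗e⊛d m (suc k)) ⟩
  sgn m * D (m + k) k - sgn m * D (m + suc k) (suc k)
    ≡⟨ cong (λ i → sgn m * D (m + k) k - sgn m * D i (suc k)) (ℕₚ.+-suc m k) ⟩
  sgn m * D (m + k) k - sgn m * D (suc (m + k)) (suc k)
    ≡⟨ cong (λ z → sgn m * D (m + k) k - sgn m * z) (binomialSum-suc k (λ j → d (suc (m + k) ∸ j))) ⟩
  sgn m * D (m + k) k - sgn m * (D (suc (m + k)) k ℚ.+ D (m + k) k)
    ≡⟨ solve 3 (λ s u v → s :* u :- s :* (v :+ u) := (con (- 1ℚ) :* s) :* v) refl (sgn m) (D (m + k) k) (D (suc (m + k)) k) ⟩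
  sgn (suc m) * D (suc m + k) k ∎
  where
  open ≡-Reasoning
  D : ℕ → ℕ → ℚ
  D n k = binomialSum k (λ j → d (n ∸ j))

alternatingSum-closedForm : ∀ a b → expSeries 1ℚ ⊛ a ⊕ a ≗ ℕ→ℚ 2 · (expSeries 1ℚ ⊛ b) →
  ∀ n k → k ≤ n →
  alternatingSum a (n ∸ k) k
    ≡ sgn (n + k + 1) * binomialSum k (λ j → a (n ∸ j)) ℚ.+ ℕ→ℚ 2 * sgn (n + k) * binomialSum k (λ j → b (n ∸ j))
alternatingSum-closedForm a b egf n k k≤n = begin
  alternatingSum a (n ∸ k) k
    ≡⟨ alternatingSum-expSeries d a≗e⊛d (n ∸ k) k ⟩
  sgn (n ∸ k) * binomialSum k (λ j → d (n ∸ k + k ∸ j))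
    ≡⟨ cong₂ (λ s i → s * binomialSum k (λ j → d (i ∸ j))) (sgn[n∸k]≡sgn[n+k] k≤n) (ℕₚ.m∸n+n≡m k≤n) ⟩
  sgn (n + k) * binomialSum k (λ j → d (n ∸ j))
    ≡⟨ cong (sgn (n + k) *_) (binomialSum-linear k (ℕ→ℚ 2) (- 1ℚ) (λ j → b (n ∸ j)) (λ j → a (n ∸ j))) ⟩
  sgn (n + k) * (ℕ→ℚ 2 * Bₙ ℚ.+ - 1ℚ * Aₙ)
    ≡⟨ solve 3 (λ s A B → s :* (con (ℕ→ℚ 2) :* B :+ con (- 1ℚ) :* A) := (s :* (con (- 1ℚ) :* con 1ℚ)) :* A :+ con (ℕ→ℚ 2) :* s :* B)
               refl (sgn (n + k)) Aₙ Bₙ ⟩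
  sgn (n + k) * sgn 1 * Aₙ ℚ.+ ℕ→ℚ 2 * sgn (n + k) * Bₙ
    ≡⟨ cong (λ s → s * Aₙ ℚ.+ ℕ→ℚ 2 * sgn (n + k) * Bₙ) (sym (sgn-homo-+ (n + k) 1)) ⟩
  sgn (n + k + 1) * Aₙ ℚ.+ ℕ→ℚ 2 * sgn (n + k) * Bₙ ∎
  where
  open ≡-Reasoning
  Aₙ Bₙ : ℚ
  Aₙ = binomialSum k (λ j → a (n ∸ j))
  Bₙ = binomialSum k (λ j → b (n ∸ j))
  d : ℕ → ℚ
  d = ℕ→ℚ 2 · b ⊕ (- 1ℚ) · a
  a≗e⊛d : a ≗ expSeries 1ℚ ⊛ d
  a≗e⊛d i = begin
    a i
      ≡⟨ solve 2 (λ y A → A := (y :+ A) :+ con (- 1ℚ) :* y) refl (e⊛a i) (a i) ⟩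
    (e⊛a i ℚ.+ a i) ℚ.+ - 1ℚ * e⊛a i
      ≡⟨ cong (ℚ._+ - 1ℚ * e⊛a i) (egf i) ⟩
    ℕ→ℚ 2 * (expSeries 1ℚ ⊛ b) i ℚ.+ - 1ℚ * e⊛a i
      ≡⟨ sym (trans (⊛-distribˡ-⊕ (expSeries 1ℚ) (ℕ→ℚ 2 · b) ((- 1ℚ) · a) i)
                    (cong₂ ℚ._+_ (⊛-scaleʳ (ℕ→ℚ 2) (expSeries 1ℚ) b i) (⊛-scaleʳ (- 1ℚ) (expSeries 1ℚ) a i))) ⟩
    (expSeries 1ℚ ⊛ d) i ∎
    where
    e⊛a : ℕ → ℚ
    e⊛a = expSeries 1ℚ ⊛ a

theorem4p5 : (p : ℕ) → 1 ≤ p → (n k : ℕ) → k ≤ n → (x : ℚ) →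
    sumTo (n ∸ k) (λ j → ℕ→ℚ ((n ∸ k) C j) * sgn j * EulerP p (j + k) x)
      ≡ Data.Rational._+_
          (sgn (n + k + 1) * sumTo k (λ j → ℕ→ℚ (k C j) * EulerP p (n ∸ j) x))
          (ℕ→ℚ 2 * sgn (n + k) * sumTo k (λ j → ℕ→ℚ (k C j) * EulerP (p ∸ 1) (n ∸ j) (x - 1ℚ)))
theorem4p5 (suc q) _ n k k≤n x =
  alternatingSum-closedForm (λ i → EulerP (suc q) i x) (λ i → EulerP q i (x - 1ℚ)) (EulerP-spec q x) n k k≤n
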